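{- Let $n \ge 3$ and let $C_n$ be the cycle with vertices $1,2,\dots,n$ in cyclic order. Then \[ R^L(C_n) = \operatorname{circ}\left(\frac{n^2-1}{6}, -\frac{1\cdot(n-1)}{n}, -\frac{2(n-2)}{n}, \ldots, -\frac{(n-1)(n-(n-1))}{n}\right), \] i.e. the circulant matrix whose first row has entry $\frac{n^2-1}{6}$ in position $0$ and entry $-\frac{m(n-m)}{n}$ in position $m$ for $1 \le m \le n-1$.
   Context: For $c_0,\dots,c_{n-1}$, $\operatorname{circ}(c_0,c_1,\dots,c_{n-1})$ denotes the $n\times n$ circulant matrix whose $(i,j)$ entry is $c_{(j-i) \bmod n}$ (positions indexed from $0$). For a connected graph $G$ with Laplacian matrix $L$ (degree matrix minus adjacency matrix), let $L^\dagger$ be its Moore–Penrose inverse. The resistance distance between vertices $i \ne j$ is $r(i,j) = L^\dagger_{ii} + L^\dagger_{jj} - 2L^\dagger_{ij}$, and $r(i,i)=0$. The resistance distance matrix $R(G)$ has $(i,j)$ entry $r(i,j)$. The resistance transmission of a vertex $v$ is $RTr(v) = \sum_{u \in V} r(u,v)$. The resistance Laplacian is $R^L(G) = \mathrm{Diag}(RTr) - R(G)$, where $\mathrm{Diag}(RTr)$ is the diagonal matrix of the resistance transmissions. -}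

module Defs where

open import Data.Nat as ℕ using (ℕ; zero; suc; _%_; _∸_)
open import Data.Fin using (Fin; zero; suc; toℕ)
open import Data.Fin.Properties using () renaming (_≟_ to _≟ᶠ_)
open import Data.Integer using (+_)
open import Data.Rational using (ℚ; 0ℚ; 1ℚ; _+_; _-_; _*_; -_; _/_)
open import Data.Bool using (Bool; true; false; if_then_else_; _∨_)
open import Relation.Nullary using (yes; no)
open import Relation.Nullary.Decidable using (⌊_⌋)
open import Relation.Binary.PropositionalEquality using (_≡_)
open import Data.Product using (_×_)

Matrix : ℕ → Set
Matrix n = Fin n → Fin n → ℚ

sumFin : ∀ n → (Fin n → ℚ) → ℚ
sumFin zero    f = 0ℚ
sumFin (suc n) f = f zero + sumFin n (λ i → f (suc i))

_⊗_ : ∀ {n} → Matrix n → Matrix n → Matrix n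
_⊗_ {n} A B i j = sumFin n (λ k → A i k * B k j)

transpose : ∀ {n} → Matrix n → Matrix n
transpose A i j = A j i

δ : ∀ {n} → Fin n → Fin n → ℚ → ℚ
δ i j x with i ≟ᶠ j
... | yes _ = x
... | no  _ = 0ℚ

-- adjacency of the cycle C_n on vertices 0,1,...,n-1 in cyclic order:
-- i ~ j iff j ≡ i+1 (mod n) or i ≡ j+1 (mod n)
cycleAdjB : ∀ n → Fin n → Fin n → Bool
cycleAdjB zero    () _
cycleAdjB (suc m) i j =
  ⌊ (toℕ i ℕ.+ 1) % suc m ℕ.≟ toℕ j ⌋ ∨ ⌊ (toℕ j ℕ.+ 1) % suc m ℕ.≟ toℕ i ⌋

cycleAdj : ∀ n → Matrix n
cycleAdj n i j = if cycleAdjB n i j then 1ℚ else 0ℚ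

degree : ∀ n → Fin n → ℚ
degree n i = sumFin n (λ j → cycleAdj n i j)

cycleLap : ∀ n → Matrix n
cycleLap n i j = δ i j (degree n i) - cycleAdj n i j

-- X is the Moore–Penrose inverse of A (four Penrose equations; real case, so * = transpose)
IsMPInverse : ∀ {n} → Matrix n → Matrix n → Set
IsMPInverse A X =
  (∀ i j → ((A ⊗ X) ⊗ A) i j ≡ A i j) ×
  (∀ i j → ((X ⊗ A) ⊗ X) i j ≡ X i j) ×
  (∀ i j → transpose (A ⊗ X) i j ≡ (A ⊗ X) i j) ×
  (∀ i j → transpose (X ⊗ A) i j ≡ (X ⊗ A) i j)

-- resistance distance computed from L† = X
resDist : ∀ {n} → Matrix n → Matrix n
resDist X i j with i ≟ᶠ j
... | yes _ = 0ℚ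
... | no  _ = X i i + X j j - (+ 2 / 1) * X i j

resTr : ∀ {n} → Matrix n → Fin n → ℚ
resTr {n} X v = sumFin n (λ u → resDist X u v)

resLap : ∀ {n} → Matrix n → Matrix n
resLap X i j = δ i j (resTr X i) - resDist X i j

-- circ(c_0,...,c_{n-1}): (i,j) entry is c_{(j-i) mod n}
circ : ∀ n → (ℕ → ℚ) → Matrix n
circ zero    c () _
circ (suc m) c i j = c ((toℕ j ℕ.+ suc m ∸ toℕ i) % suc m)

cycleRow : ℕ → ℕ → ℚ
cycleRow zero    _       = 0ℚ
cycleRow (suc k) zero    = + (suc k ℕ.* suc k ∸ 1) / 6
cycleRow (suc k) (suc m) = - (+ (suc m ℕ.* (suc k ∸ suc m)) / suc k)

-- The Laplacian of the cycle acts on a circulant matrix as a cyclic second difference.  The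
-- circulant L⁺ whose entry at offset x is g x = (n² − 1)/12n − x(n − x)/2n has second difference
-- 1 − 1/n at offset 0 and −1/n elsewhere, so L L⁺ = L⁺ L = I − J/n; as L and L⁺ have zero column
-- sums, L⁺ satisfies the Penrose equations, and the Moore–Penrose inverse is unique.  Hence
-- r(i, j) = 2 g 0 − 2 g x = x(n − x)/n, and every transmission is 2 n g 0 = (n² − 1)/6, because
-- the offsets of a column run over all residues, on which g sums to 0.
module Submission where

open import Defs
open import Algebra.Bundles using (Ring)
open import Data.Empty using (⊥-elim)
open import Data.Fin as Fin using (Fin; zero; suc; toℕ; fromℕ<; punchIn)
open import Data.Fin.Properties
  using (toℕ<n; toℕ-fromℕ<; toℕ-injective; toℕ-inject₁; toℕ-fromℕ; punchInᵢ≢i)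
  renaming (_≟_ to _≟ᶠ_)
import Data.Fin.Permutation as Perm
open import Data.Integer as ℤ using (+_)
import Data.Integer.Properties as ℤ
import Data.Integer.Solver as ℤSolver
open import Data.Nat as ℕ using (ℕ; zero; suc; _≤_; _<_; _∸_; _%_; s≤s)
import Data.Nat.Properties as ℕ
open import Data.Nat.DivMod using (m%n<n; m<n⇒m%n≡m; n%n≡0; [m+n]%n≡m%n; m%n%n≡m%n; %-distribˡ-+)
open import Data.Product using (_×_; ∃; _,_)
open import Data.Rational using (ℚ; 0ℚ; 1ℚ; ½; _+_; _-_; _*_; -_; _/_; toℚᵘ)
open import Data.Rational.Properties
  using (+-*-ring; +-comm; +-identityˡ; +-identityʳ; *-identityˡ; *-identityʳ; *-assoc; *-comm; *-zeroˡ;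
         *-distribʳ-+; neg-distrib-+; toℚᵘ-injective; toℚᵘ-fromℚᵘ; toℚᵘ-homo-+; toℚᵘ-homo-*)
open import Data.Rational.Solver using (module +-*-Solver)
import Data.Rational.Unnormalised as ℚᵘ
import Data.Rational.Unnormalised.Properties as ℚᵘ
open import Data.Sum using (_⊎_; inj₁; inj₂)
open import Data.Bool using (if_then_else_; _∨_)
open import Data.Bool.Properties using (∨-comm)
open import Function using (_∘_)
open import Level using (0ℓ)
open import Relation.Binary.Bundles using (Setoid)
open import Relation.Binary.Definitions using (tri<; tri≈; tri>)
open import Relation.Binary.PropositionalEquality
open import Relation.Nullary using (Dec; yes; no)
open import Relation.Nullary.Decidable using (⌊_⌋)

open import Algebra.Properties.Semiring.Sum (Ring.semiring +-*-ring)
  using (sum; sum-cong-≗; ∑-distrib-+; ∑-comm; *-distribˡ-sum; *-distribʳ-sum;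
         sum-permute; sum-remove; sum-replicate-zero; sum-init-last)
open +-*-Solver using (Polynomial; solve; _:+_; _:-_; _:*_; :-_; _:=_; con)

sumFin≡sum : ∀ n (f : Fin n → ℚ) → sumFin n f ≡ sum f
sumFin≡sum zero    f = refl
sumFin≡sum (suc n) f = cong (_+_ (f zero)) (sumFin≡sum n (λ i → f (suc i)))

sumFin-cong : ∀ n {f g : Fin n → ℚ} → (∀ i → f i ≡ g i) → sumFin n f ≡ sumFin n g
sumFin-cong n {f} {g} f≗g =
  trans (sumFin≡sum n f) (trans (sum-cong-≗ f≗g) (sym (sumFin≡sum n g)))

sum-neg : ∀ {n} (f : Fin n → ℚ) → sum (λ i → - f i) ≡ - sum f
sum-neg {zero}  f = refl
sum-neg {suc n} f =
  trans (cong (_+_ (- f zero)) (sum-neg (λ i → f (suc i)))) (sym (neg-distrib-+ (f zero) _))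

∑-distrib-- : ∀ {n} (f g : Fin n → ℚ) → sum (λ i → f i - g i) ≡ sum f - sum g
∑-distrib-- f g = trans (∑-distrib-+ f (λ i → - g i)) (cong (_+_ (sum f)) (sum-neg g))

sum-∘-involutive : ∀ {n} (ρ : Fin n → Fin n) → (∀ i → ρ (ρ i) ≡ i) →
                   (f : Fin n → ℚ) → sum (λ i → f (ρ i)) ≡ sum f
sum-∘-involutive ρ ρ∘ρ≗id f = sym (sum-permute f (Perm.permutation ρ ρ ρ∘ρ≗id ρ∘ρ≗id))

δ-≡ : ∀ {n} {i j : Fin n} c → i ≡ j → δ i j c ≡ c
δ-≡ {i = i} {j} c i≡j with i ≟ᶠ j
... | yes _   = refl
... | no  i≢j = ⊥-elim (i≢j i≡j)

δ-≢ : ∀ {n} {i j : Fin n} c → i ≢ j → δ i j c ≡ 0ℚ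
δ-≢ {i = i} {j} c i≢j with i ≟ᶠ j
... | yes i≡j = ⊥-elim (i≢j i≡j)
... | no  _   = refl

δ-sym : ∀ {n} (i j : Fin n) c → δ i j c ≡ δ j i c
δ-sym i j c with i ≟ᶠ j
... | yes refl = sym (δ-≡ {i = i} c refl)
... | no  i≢j  = sym (δ-≢ c (i≢j ∘ sym))

sum-δ : ∀ {n} (i : Fin n) c (g : Fin n → ℚ) → sum (λ k → δ i k c * g k) ≡ c * g i
sum-δ {suc n} i c g = begin
  sum t                      ≡⟨ sum-remove {i = i} t ⟩
  t i + sum (λ k → t (punchIn i k))
    ≡⟨ cong₂ _+_ (cong (_* g i) (δ-≡ {i = i} c refl)) (trans (sum-cong-≗ off-i) (sum-replicate-zero n)) ⟩
  c * g i + 0ℚ               ≡⟨ +-identityʳ _ ⟩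
  c * g i                    ∎
  where
  open ≡-Reasoning
  t : Fin (suc n) → ℚ
  t k = δ i k c * g k
  off-i : ∀ k → t (punchIn i k) ≡ 0ℚ
  off-i k = trans (cong (_* g (punchIn i k)) (δ-≢ c (punchInᵢ≢i i k ∘ sym))) (*-zeroˡ (g (punchIn i k)))

infix 4 _≈_
_≈_ : ∀ {n} → Matrix n → Matrix n → Set
A ≈ B = ∀ i j → A i j ≡ B i j

≈-setoid : ℕ → Setoid 0ℓ 0ℓ
≈-setoid n = record
  { Carrier       = Matrix n
  ; _≈_           = _≈_
  ; isEquivalence = record
    { refl  = λ _ _ → refl
    ; sym   = λ A≈B i j → sym (A≈B i j)
    ; trans = λ A≈B B≈C i j → trans (A≈B i j) (B≈C i j)
    }
  }

IsSymmetric : ∀ {n} → Matrix n → Set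
IsSymmetric A = transpose A ≈ A

⊗≡sum : ∀ {n} (A B : Matrix n) i j → (A ⊗ B) i j ≡ sum (λ k → A i k * B k j)
⊗≡sum {n} A B i j = sumFin≡sum n (λ k → A i k * B k j)

⊗-congˡ : ∀ {n} {A B : Matrix n} (C : Matrix n) → A ≈ B → A ⊗ C ≈ B ⊗ C
⊗-congˡ {n} C A≈B i j = sumFin-cong n (λ k → cong (_* C k j) (A≈B i k))

⊗-congʳ : ∀ {n} {A B : Matrix n} (C : Matrix n) → A ≈ B → C ⊗ A ≈ C ⊗ B
⊗-congʳ {n} C A≈B i j = sumFin-cong n (λ k → cong (C i k *_) (A≈B k j))

transpose-cong : ∀ {n} {A B : Matrix n} → A ≈ B → transpose A ≈ transpose B
transpose-cong A≈B i j = A≈B j i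

transpose-⊗ : ∀ {n} (A B : Matrix n) → transpose (A ⊗ B) ≈ transpose B ⊗ transpose A
transpose-⊗ {n} A B i j = sumFin-cong n (λ k → *-comm (A j k) (B k i))

⊗-assoc : ∀ {n} (A B C : Matrix n) → (A ⊗ B) ⊗ C ≈ A ⊗ (B ⊗ C)
⊗-assoc {n} A B C i j = begin
  ((A ⊗ B) ⊗ C) i j                                  ≡⟨ ⊗≡sum (A ⊗ B) C i j ⟩
  sum (λ k → (A ⊗ B) i k * C k j)
    ≡⟨ sum-cong-≗ (λ k → trans (cong (_* C k j) (⊗≡sum A B i k)) (*-distribʳ-sum (C k j) (λ l → A i l * B l k))) ⟩
  sum (λ k → sum (λ l → A i l * B l k * C k j))     ≡⟨ ∑-comm (λ k l → A i l * B l k * C k j) ⟩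
  sum (λ l → sum (λ k → A i l * B l k * C k j))
    ≡⟨ sum-cong-≗ (λ l → trans (sum-cong-≗ (λ k → *-assoc (A i l) (B l k) (C k j)))
                               (sym (*-distribˡ-sum (A i l) (λ k → B l k * C k j)))) ⟩
  sum (λ l → A i l * sum (λ k → B l k * C k j))
    ≡⟨ sum-cong-≗ (λ l → cong (A i l *_) (sym (⊗≡sum B C l j))) ⟩
  sum (λ l → A i l * (B ⊗ C) l j)                   ≡⟨ ⊗≡sum A (B ⊗ C) i j ⟨
  (A ⊗ (B ⊗ C)) i j                                  ∎
  where open ≡-Reasoning

⊗-flip : ∀ {n} {A B : Matrix n} → IsSymmetric A → IsSymmetric B → A ⊗ B ≈ transpose (B ⊗ A)
⊗-flip {n} {A} {B} A-sym B-sym i j =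
  sumFin-cong n (λ k → trans (cong₂ _*_ (A-sym k i) (B-sym j k)) (*-comm (A k i) (B j k)))

-- Moore–Penrose inverses

module _ {n : ℕ} {A : Matrix n} where

  open import Relation.Binary.Reasoning.Setoid (≈-setoid n)

  isMPInverse : ∀ {X E : Matrix n} → A ⊗ X ≈ E → X ⊗ A ≈ E → IsSymmetric E →
                E ⊗ A ≈ A → E ⊗ X ≈ X → IsMPInverse A X
  isMPInverse {X} {E} AX≈E XA≈E E-sym EA≈A EX≈X =
      (λ i j → trans (⊗-congˡ A AX≈E i j) (EA≈A i j))
    , (λ i j → trans (⊗-congˡ X XA≈E i j) (EX≈X i j))
    , (λ i j → trans (AX≈E j i) (trans (E-sym i j) (sym (AX≈E i j))))
    , (λ i j → trans (XA≈E j i) (trans (E-sym i j) (sym (XA≈E i j))))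

  IsMPInverse-unique : ∀ {X Y : Matrix n} → IsMPInverse A X → IsMPInverse A Y → X ≈ Y
  IsMPInverse-unique {X} {Y} (AXA≈A , XAX≈X , AX-sym , XA-sym) (AYA≈A , YAY≈Y , AY-sym , YA-sym) =
    begin
      X                 ≈⟨ X≈XAY ⟩
      X ⊗ (A ⊗ Y)       ≈⟨ ⊗-assoc X A Y ⟨
      (X ⊗ A) ⊗ Y       ≈⟨ Y≈XAY ⟨
      Y                 ∎
    where
    Aᵀ = transpose A
    Xᵀ = transpose X
    Yᵀ = transpose Y

    Aᵀ≈AᵀAY : Aᵀ ≈ Aᵀ ⊗ (A ⊗ Y)
    Aᵀ≈AᵀAY = begin
      Aᵀ                        ≈⟨ transpose-cong AYA≈A ⟨
      transpose ((A ⊗ Y) ⊗ A)   ≈⟨ transpose-⊗ (A ⊗ Y) A ⟩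
      Aᵀ ⊗ transpose (A ⊗ Y)    ≈⟨ ⊗-congʳ Aᵀ AY-sym ⟩
      Aᵀ ⊗ (A ⊗ Y)              ∎

    Aᵀ≈XAAᵀ : Aᵀ ≈ (X ⊗ A) ⊗ Aᵀ
    Aᵀ≈XAAᵀ = begin
      Aᵀ                        ≈⟨ transpose-cong AXA≈A ⟨
      transpose ((A ⊗ X) ⊗ A)   ≈⟨ transpose-cong (⊗-assoc A X A) ⟩
      transpose (A ⊗ (X ⊗ A))   ≈⟨ transpose-⊗ A (X ⊗ A) ⟩
      transpose (X ⊗ A) ⊗ Aᵀ    ≈⟨ ⊗-congˡ Aᵀ XA-sym ⟩
      (X ⊗ A) ⊗ Aᵀ              ∎

    X≈XAY : X ≈ X ⊗ (A ⊗ Y)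
    X≈XAY = begin
      X                                ≈⟨ XAX≈X ⟨
      (X ⊗ A) ⊗ X                      ≈⟨ ⊗-assoc X A X ⟩
      X ⊗ (A ⊗ X)                      ≈⟨ ⊗-congʳ X AX-sym ⟨
      X ⊗ transpose (A ⊗ X)            ≈⟨ ⊗-congʳ X (transpose-⊗ A X) ⟩
      X ⊗ (Xᵀ ⊗ Aᵀ)                    ≈⟨ ⊗-congʳ X (⊗-congʳ Xᵀ Aᵀ≈AᵀAY) ⟩
      X ⊗ (Xᵀ ⊗ (Aᵀ ⊗ (A ⊗ Y)))        ≈⟨ ⊗-congʳ X (⊗-assoc Xᵀ Aᵀ (A ⊗ Y)) ⟨
      X ⊗ ((Xᵀ ⊗ Aᵀ) ⊗ (A ⊗ Y))        ≈⟨ ⊗-congʳ X (⊗-congˡ (A ⊗ Y) (transpose-⊗ A X)) ⟨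
      X ⊗ (transpose (A ⊗ X) ⊗ (A ⊗ Y)) ≈⟨ ⊗-congʳ X (⊗-congˡ (A ⊗ Y) AX-sym) ⟩
      X ⊗ ((A ⊗ X) ⊗ (A ⊗ Y))          ≈⟨ ⊗-congʳ X (⊗-assoc (A ⊗ X) A Y) ⟨
      X ⊗ (((A ⊗ X) ⊗ A) ⊗ Y)          ≈⟨ ⊗-congʳ X (⊗-congˡ Y AXA≈A) ⟩
      X ⊗ (A ⊗ Y)                      ∎

    Y≈XAY : Y ≈ (X ⊗ A) ⊗ Y
    Y≈XAY = begin
      Y                                ≈⟨ YAY≈Y ⟨
      (Y ⊗ A) ⊗ Y                      ≈⟨ ⊗-congˡ Y YA-sym ⟨
      transpose (Y ⊗ A) ⊗ Y            ≈⟨ ⊗-congˡ Y (transpose-⊗ Y A) ⟩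
      (Aᵀ ⊗ Yᵀ) ⊗ Y                    ≈⟨ ⊗-congˡ Y (⊗-congˡ Yᵀ Aᵀ≈XAAᵀ) ⟩
      (((X ⊗ A) ⊗ Aᵀ) ⊗ Yᵀ) ⊗ Y        ≈⟨ ⊗-congˡ Y (⊗-assoc (X ⊗ A) Aᵀ Yᵀ) ⟩
      ((X ⊗ A) ⊗ (Aᵀ ⊗ Yᵀ)) ⊗ Y        ≈⟨ ⊗-congˡ Y (⊗-congʳ (X ⊗ A) (transpose-⊗ Y A)) ⟨
      ((X ⊗ A) ⊗ transpose (Y ⊗ A)) ⊗ Y ≈⟨ ⊗-congˡ Y (⊗-congʳ (X ⊗ A) YA-sym) ⟩
      ((X ⊗ A) ⊗ (Y ⊗ A)) ⊗ Y          ≈⟨ ⊗-assoc (X ⊗ A) (Y ⊗ A) Y ⟩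
      (X ⊗ A) ⊗ ((Y ⊗ A) ⊗ Y)          ≈⟨ ⊗-congʳ (X ⊗ A) YAY≈Y ⟩
      (X ⊗ A) ⊗ Y                      ∎

2ℚ : ℚ
2ℚ = + 2 / 1

resDist-formula : ∀ {n} (X : Matrix n) i j → resDist X i j ≡ X i i + X j j - 2ℚ * X i j
resDist-formula X i j with i ≟ᶠ j
... | yes refl = solve 1 (λ x → con 0ℚ := x :+ x :- con 2ℚ :* x) refl (X i i)
... | no  _    = refl

resDist-cong : ∀ {n} {X Y : Matrix n} → X ≈ Y → resDist X ≈ resDist Y
resDist-cong {X = X} {Y} X≈Y i j = begin
  resDist X i j                    ≡⟨ resDist-formula X i j ⟩
  X i i + X j j - 2ℚ * X i j       ≡⟨ cong₂ (λ a b → a - 2ℚ * b) (cong₂ _+_ (X≈Y i i) (X≈Y j j)) (X≈Y i j) ⟩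
  Y i i + Y j j - 2ℚ * Y i j       ≡⟨ resDist-formula Y i j ⟨
  resDist Y i j                    ∎
  where open ≡-Reasoning

resLap-cong : ∀ {n} {X Y : Matrix n} → X ≈ Y → resLap X ≈ resLap Y
resLap-cong {n} X≈Y i j =
  cong₂ _-_ (cong (δ i j) (sumFin-cong n (λ u → resDist-cong X≈Y u i))) (resDist-cong X≈Y i j)

toℚ : ℕ → ℚ
toℚ x = + x / 1

private
  toℚᵘ-/ : ∀ x d → toℚᵘ (+ x / suc d) ℚᵘ.≃ ℚᵘ.mkℚᵘ (+ x) d
  toℚᵘ-/ x d = toℚᵘ-fromℚᵘ (ℚᵘ.mkℚᵘ (+ x) d)

  open ℤSolver.+-*-Solver using () renaming
    (solve to ℤsolve; _:+_ to _⊕_; _:*_ to _⊛_; _:=_ to _≐_; con to ℤcon)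

toℚ-+ : ∀ a b → toℚ (a ℕ.+ b) ≡ toℚ a + toℚ b
toℚ-+ a b = toℚᵘ-injective (begin
  toℚᵘ (toℚ (a ℕ.+ b))                            ≈⟨ toℚᵘ-/ (a ℕ.+ b) 0 ⟩
  ℚᵘ.mkℚᵘ (+ (a ℕ.+ b)) 0                         ≈⟨ ℚᵘ.*≡* eq ⟩
  ℚᵘ.mkℚᵘ (+ a) 0 ℚᵘ.+ ℚᵘ.mkℚᵘ (+ b) 0             ≈⟨ ℚᵘ.+-cong (toℚᵘ-/ a 0) (toℚᵘ-/ b 0) ⟨
  toℚᵘ (toℚ a) ℚᵘ.+ toℚᵘ (toℚ b)                  ≈⟨ toℚᵘ-homo-+ (toℚ a) (toℚ b) ⟨
  toℚᵘ (toℚ a + toℚ b)                            ∎)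
  where
  open ℚᵘ.≃-Reasoning
  eq : + (a ℕ.+ b) ℤ.* (+ 1 ℤ.* + 1) ≡ (+ a ℤ.* + 1 ℤ.+ + b ℤ.* + 1) ℤ.* + 1
  eq = ℤsolve 2 (λ x y → (x ⊕ y) ⊛ (ℤcon (+ 1) ⊛ ℤcon (+ 1)) ≐ (x ⊛ ℤcon (+ 1) ⊕ y ⊛ ℤcon (+ 1)) ⊛ ℤcon (+ 1))
              refl (+ a) (+ b)

toℚ-* : ∀ a b → toℚ (a ℕ.* b) ≡ toℚ a * toℚ b
toℚ-* a b = toℚᵘ-injective (begin
  toℚᵘ (toℚ (a ℕ.* b))                            ≈⟨ toℚᵘ-/ (a ℕ.* b) 0 ⟩
  ℚᵘ.mkℚᵘ (+ (a ℕ.* b)) 0                         ≈⟨ ℚᵘ.*≡* eq ⟩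
  ℚᵘ.mkℚᵘ (+ a) 0 ℚᵘ.* ℚᵘ.mkℚᵘ (+ b) 0             ≈⟨ ℚᵘ.*-cong (toℚᵘ-/ a 0) (toℚᵘ-/ b 0) ⟨
  toℚᵘ (toℚ a) ℚᵘ.* toℚᵘ (toℚ b)                  ≈⟨ toℚᵘ-homo-* (toℚ a) (toℚ b) ⟨
  toℚᵘ (toℚ a * toℚ b)                            ∎)
  where
  open ℚᵘ.≃-Reasoning
  eq : + (a ℕ.* b) ℤ.* (+ 1 ℤ.* + 1) ≡ (+ a ℤ.* + b) ℤ.* + 1
  eq = trans (cong (ℤ._* (+ 1 ℤ.* + 1)) (ℤ.pos-* a b))
             (ℤsolve 2 (λ x y → (x ⊛ y) ⊛ (ℤcon (+ 1) ⊛ ℤcon (+ 1)) ≐ (x ⊛ y) ⊛ ℤcon (+ 1)) refl (+ a) (+ b))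

toℚ-suc : ∀ a → toℚ (suc a) ≡ 1ℚ + toℚ a
toℚ-suc = toℚ-+ 1

toℚ-∸ : ∀ {a b} → b ≤ a → toℚ (a ∸ b) ≡ toℚ a - toℚ b
toℚ-∸ {a} {b} b≤a = begin
  toℚ (a ∸ b)                 ≡⟨ solve 2 (λ x y → x := (x :+ y) :- y) refl (toℚ (a ∸ b)) (toℚ b) ⟩
  toℚ (a ∸ b) + toℚ b - toℚ b ≡⟨ cong (_- toℚ b) (toℚ-+ (a ∸ b) b) ⟨
  toℚ (a ∸ b ℕ.+ b) - toℚ b   ≡⟨ cong (λ x → toℚ x - toℚ b) (ℕ.m∸n+n≡m b≤a) ⟩
  toℚ a - toℚ b               ∎
  where open ≡-Reasoning

/-*-cancel : ∀ x d → (+ x / suc d) * toℚ (suc d) ≡ toℚ x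
/-*-cancel x d = toℚᵘ-injective (begin
  toℚᵘ ((+ x / suc d) * toℚ (suc d))                 ≈⟨ toℚᵘ-homo-* (+ x / suc d) (toℚ (suc d)) ⟩
  toℚᵘ (+ x / suc d) ℚᵘ.* toℚᵘ (toℚ (suc d))         ≈⟨ ℚᵘ.*-cong (toℚᵘ-/ x d) (toℚᵘ-/ (suc d) 0) ⟩
  ℚᵘ.mkℚᵘ (+ x) d ℚᵘ.* ℚᵘ.mkℚᵘ (+ suc d) 0          ≈⟨ ℚᵘ.*≡* eq ⟩
  ℚᵘ.mkℚᵘ (+ x) 0                                    ≈⟨ toℚᵘ-/ x 0 ⟨
  toℚᵘ (toℚ x)                                       ∎)
  where
  open ℚᵘ.≃-Reasoning
  eq : (+ x ℤ.* + suc d) ℤ.* + 1 ≡ + x ℤ.* (+ suc d ℤ.* + 1)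
  eq = ℤsolve 2 (λ x y → (x ⊛ y) ⊛ ℤcon (+ 1) ≐ x ⊛ (y ⊛ ℤcon (+ 1))) refl (+ x) (+ suc d)

/≡*1/ : ∀ x d → + x / suc d ≡ toℚ x * (+ 1 / suc d)
/≡*1/ x d = begin
  q                          ≡⟨ *-identityʳ q ⟨
  q * 1ℚ                     ≡⟨ cong (q *_) (/-*-cancel 1 d) ⟨
  q * (w * D)                ≡⟨ solve 3 (λ q w D → q :* (w :* D) := (q :* D) :* w) refl q w D ⟩
  (q * D) * w                ≡⟨ cong (_* w) (/-*-cancel x d) ⟩
  toℚ x * w                  ∎
  where
  open ≡-Reasoning
  q = + x / suc d
  w = + 1 / suc d
  D = toℚ (suc d)

sum-const : ∀ n c → sum {n} (λ _ → c) ≡ c * toℚ n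
sum-const zero    c = solve 1 (λ c → con 0ℚ := c :* con 0ℚ) refl c
sum-const (suc n) c = begin
  c + sum {n} (λ _ → c)   ≡⟨ cong (_+_ c) (sum-const n c) ⟩
  c + c * toℚ n           ≡⟨ solve 2 (λ c x → c :+ c :* x := c :* (con 1ℚ :+ x)) refl c (toℚ n) ⟩
  c * (1ℚ + toℚ n)        ≡⟨ cong (c *_) (toℚ-suc n) ⟨
  c * toℚ (suc n)         ∎
  where open ≡-Reasoning

quadratic : ℚ → ℚ → ℚ → ℚ → ℚ
quadratic a b c x = a + b * x + c * (x * x)

quadraticSum : ℚ → ℚ → ℚ → ℚ → ℚ
quadraticSum a b c x = a * x + b * (x * (x - 1ℚ) * ½) + c * ((x - 1ℚ) * x * (2ℚ * x - 1ℚ) * (+ 1 / 6))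

quadraticᴾ quadraticSumᴾ : ∀ {v} → Polynomial v → Polynomial v → Polynomial v → Polynomial v → Polynomial v
quadraticᴾ a b c x = a :+ b :* x :+ c :* (x :* x)
quadraticSumᴾ a b c x =
  a :* x :+ b :* (x :* (x :- con 1ℚ) :* con ½) :+ c :* ((x :- con 1ℚ) :* x :* (con 2ℚ :* x :- con 1ℚ) :* con (+ 1 / 6))

sum-quadratic : ∀ n a b c → sum (λ (i : Fin n) → quadratic a b c (toℚ (toℕ i))) ≡ quadraticSum a b c (toℚ n)
sum-quadratic zero    a b c = solve 3 (λ a b c → con 0ℚ := quadraticSumᴾ a b c (con 0ℚ)) refl a b c
sum-quadratic (suc n) a b c = begin
  sum q                                                  ≡⟨ sum-init-last q ⟩
  sum (λ i → q (Fin.inject₁ i)) + q (Fin.fromℕ n)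
    ≡⟨ cong₂ _+_ (sum-cong-≗ {x = λ i → q (Fin.inject₁ i)} {y = λ i → quadratic a b c (toℚ (toℕ i))}
                             (λ i → cong (quadratic a b c ∘ toℚ) (toℕ-inject₁ i)))
                 (cong (quadratic a b c ∘ toℚ) (toℕ-fromℕ n)) ⟩
  sum (λ (i : Fin n) → quadratic a b c (toℚ (toℕ i))) + quadratic a b c (toℚ n)
    ≡⟨ cong (_+ quadratic a b c (toℚ n)) (sum-quadratic n a b c) ⟩
  quadraticSum a b c (toℚ n) + quadratic a b c (toℚ n)
    ≡⟨ solve 4 (λ a b c x → quadraticSumᴾ a b c x :+ quadraticᴾ a b c x := quadraticSumᴾ a b c (con 1ℚ :+ x))
               refl a b c (toℚ n) ⟩
  quadraticSum a b c (1ℚ + toℚ n)                        ≡⟨ cong (quadraticSum a b c) (toℚ-suc n) ⟨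
  quadraticSum a b c (toℚ (suc n))                       ∎
  where
  open ≡-Reasoning
  q : Fin (suc n) → ℚ
  q i = quadratic a b c (toℚ (toℕ i))

-- Arithmetic modulo n

module Cyclic (m : ℕ) where

  n : ℕ
  n = suc m

  next : ℕ → ℕ
  next a = (a ℕ.+ 1) % n

  prev : ℕ → ℕ
  prev zero    = m
  prev (suc a) = a

  -- b ⊖ a is the offset (b − a) mod n; it is chosen so that circ n c i j = c (toℕ j ⊖ toℕ i).
  infixl 6 _⊖_
  _⊖_ : ℕ → ℕ → ℕ
  b ⊖ a = (b ℕ.+ n ∸ a) % n

  next<n : ∀ a → next a < n
  next<n a = m%n<n (a ℕ.+ 1) n

  prev<n : ∀ {a} → a < n → prev a < n
  prev<n {zero}  _     = ℕ.n<1+n m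
  prev<n {suc a} 1+a<n = ℕ.<-trans (ℕ.n<1+n a) 1+a<n

  ⊖<n : ∀ a b → b ⊖ a < n
  ⊖<n a b = m%n<n (b ℕ.+ n ∸ a) n

  next-< : ∀ {a} → suc a < n → next a ≡ suc a
  next-< {a} 1+a<n = trans (cong (_% n) (ℕ.+-comm a 1)) (m<n⇒m%n≡m 1+a<n)

  next-last : next m ≡ 0
  next-last = trans (cong (_% n) (ℕ.+-comm m 1)) (n%n≡0 n)

  next-% : ∀ a → next (a % n) ≡ next a
  next-% a = begin
    (a % n ℕ.+ 1) % n          ≡⟨ %-distribˡ-+ (a % n) 1 n ⟩
    (a % n % n ℕ.+ 1 % n) % n  ≡⟨ cong (λ x → (x ℕ.+ 1 % n) % n) (m%n%n≡m%n a n) ⟩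
    (a % n ℕ.+ 1 % n) % n      ≡⟨ %-distribˡ-+ a 1 n ⟨
    (a ℕ.+ 1) % n              ∎
    where open ≡-Reasoning

  prev-next : ∀ {a} → a < n → prev (next a) ≡ a
  prev-next {a} a<n with ℕ.m≤n⇒m<n∨m≡n (ℕ.≤-pred a<n)
  ... | inj₁ a<m  = cong prev (next-< (s≤s a<m))
  ... | inj₂ refl = cong prev next-last

  next-prev : ∀ {a} → a < n → next (prev a) ≡ a
  next-prev {zero}  _     = next-last
  next-prev {suc a} 1+a<n = next-< 1+a<n

  ⊖-≤ : ∀ {a b} → a ≤ b → b < n → b ⊖ a ≡ b ∸ a
  ⊖-≤ {a} {b} a≤b b<n = begin
    (b ℕ.+ n ∸ a) % n   ≡⟨ cong (_% n) (ℕ.+-∸-comm n a≤b) ⟩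
    (b ∸ a ℕ.+ n) % n   ≡⟨ [m+n]%n≡m%n (b ∸ a) n ⟩
    (b ∸ a) % n         ≡⟨ m<n⇒m%n≡m (ℕ.≤-<-trans (ℕ.m∸n≤m b a) b<n) ⟩
    b ∸ a               ∎
    where open ≡-Reasoning

  ⊖-> : ∀ {a b} → b < a → a < n → b ⊖ a ≡ b ℕ.+ n ∸ a
  ⊖-> {a} {b} b<a a<n = m<n⇒m%n≡m (ℕ.m<n+o⇒m∸n<o (b ℕ.+ n) a (ℕ.+-monoˡ-< n b<a))

  ⊖-self : ∀ a → a ⊖ a ≡ 0
  ⊖-self a = trans (cong (_% n) (ℕ.m+n∸m≡n a n)) (n%n≡0 n)

  ⊖-zero : ∀ {b} → b < n → b ⊖ 0 ≡ b
  ⊖-zero {b} b<n = trans ([m+n]%n≡m%n b n) (m<n⇒m%n≡m b<n)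

  ⊖-suc : ∀ {a} b → a < n → b ⊖ a ≡ next (b ⊖ suc a)
  ⊖-suc {a} b a<n = begin
    (b ℕ.+ n ∸ a) % n             ≡⟨ cong (_% n) (ℕ.+-∸-assoc 1 1+a≤b+n) ⟩
    suc (b ℕ.+ n ∸ suc a) % n     ≡⟨ cong (_% n) (ℕ.+-comm 1 (b ℕ.+ n ∸ suc a)) ⟩
    next (b ℕ.+ n ∸ suc a)        ≡⟨ next-% (b ℕ.+ n ∸ suc a) ⟨
    next (b ⊖ suc a)              ∎
    where
    open ≡-Reasoning
    1+a≤b+n : suc a ≤ b ℕ.+ n
    1+a≤b+n = ℕ.≤-trans a<n (ℕ.m≤n+m n b)

  ⊖-next : ∀ {a} b → a < n → b ⊖ next a ≡ prev (b ⊖ a)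
  ⊖-next {a} b a<n = begin
    b ⊖ next a                ≡⟨ ⊖-next≡⊖-suc (ℕ.m≤n⇒m<n∨m≡n a<n) ⟩
    b ⊖ suc a                 ≡⟨ prev-next (⊖<n (suc a) b) ⟨
    prev (next (b ⊖ suc a))   ≡⟨ cong prev (⊖-suc b a<n) ⟨
    prev (b ⊖ a)              ∎
    where
    open ≡-Reasoning
    ⊖-next≡⊖-suc : suc a < n ⊎ suc a ≡ n → b ⊖ next a ≡ b ⊖ suc a
    ⊖-next≡⊖-suc (inj₁ 1+a<n) = cong (b ⊖_) (next-< 1+a<n)
    ⊖-next≡⊖-suc (inj₂ refl)  =
      trans (cong (b ⊖_) next-last)
            (trans ([m+n]%n≡m%n b n) (cong (_% n) (sym (ℕ.m+n∸n≡m b n))))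

  ⊖-prev : ∀ {a} b → a < n → b ⊖ prev a ≡ next (b ⊖ a)
  ⊖-prev {a} b a<n = begin
    b ⊖ prev a                       ≡⟨ next-prev (⊖<n (prev a) b) ⟨
    next (prev (b ⊖ prev a))         ≡⟨ cong next (⊖-next b (prev<n a<n)) ⟨
    next (b ⊖ next (prev a))         ≡⟨ cong (λ x → next (b ⊖ x)) (next-prev a<n) ⟩
    next (b ⊖ a)                     ∎
    where open ≡-Reasoning

  ⊖-involutive : ∀ {a b} → a < n → b < n → b ⊖ (b ⊖ a) ≡ a
  ⊖-involutive {a} {b} a<n b<n with a ℕ.≤? b
  ... | yes a≤b = begin
    b ⊖ (b ⊖ a)     ≡⟨ cong (b ⊖_) (⊖-≤ a≤b b<n) ⟩
    b ⊖ (b ∸ a)     ≡⟨ ⊖-≤ (ℕ.m∸n≤m b a) b<n ⟩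
    b ∸ (b ∸ a)     ≡⟨ ℕ.m∸[m∸n]≡n a≤b ⟩
    a               ∎
    where open ≡-Reasoning
  ... | no  a≰b = begin
    b ⊖ (b ⊖ a)               ≡⟨ cong (b ⊖_) (⊖-> b<a a<n) ⟩
    b ⊖ (b ℕ.+ n ∸ a)         ≡⟨ ⊖-> b<b+n-a b+n-a<n ⟩
    b ℕ.+ n ∸ (b ℕ.+ n ∸ a)   ≡⟨ ℕ.m∸[m∸n]≡n (ℕ.≤-trans (ℕ.<⇒≤ a<n) (ℕ.m≤n+m n b)) ⟩
    a                         ∎
    where
    open ≡-Reasoning
    b<a : b < a
    b<a = ℕ.≰⇒> a≰b
    b+n-a<n : b ℕ.+ n ∸ a < n
    b+n-a<n = subst (_< n) (⊖-> b<a a<n) (⊖<n a b)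
    b<b+n-a : b < b ℕ.+ n ∸ a
    b<b+n-a = subst (b <_) (sym (ℕ.+-∸-assoc b (ℕ.<⇒≤ a<n))) (ℕ.m<m+n b (ℕ.m<n⇒0<n∸m a<n))

  ⊖≡0⇒≡ : ∀ {a b} → a < n → b < n → b ⊖ a ≡ 0 → a ≡ b
  ⊖≡0⇒≡ {a} {b} a<n b<n b⊖a≡0 = begin
    a               ≡⟨ ⊖-involutive a<n b<n ⟨
    b ⊖ (b ⊖ a)     ≡⟨ cong (b ⊖_) b⊖a≡0 ⟩
    b ⊖ 0           ≡⟨ ⊖-zero b<n ⟩
    b               ∎
    where open ≡-Reasoning

  N : ℚ
  N = toℚ n

  toℚ-⊖-≤ : ∀ {a b} → a ≤ b → b < n → toℚ (b ⊖ a) ≡ toℚ b - toℚ a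
  toℚ-⊖-≤ a≤b b<n = trans (cong toℚ (⊖-≤ a≤b b<n)) (toℚ-∸ a≤b)

  toℚ-⊖-> : ∀ {a b} → b < a → a < n → toℚ (b ⊖ a) ≡ toℚ b + N - toℚ a
  toℚ-⊖-> {a} {b} b<a a<n = begin
    toℚ (b ⊖ a)             ≡⟨ cong toℚ (⊖-> b<a a<n) ⟩
    toℚ (b ℕ.+ n ∸ a)       ≡⟨ toℚ-∸ (ℕ.≤-trans (ℕ.<⇒≤ a<n) (ℕ.m≤n+m n b)) ⟩
    toℚ (b ℕ.+ n) - toℚ a   ≡⟨ cong (_- toℚ a) (toℚ-+ b n) ⟩
    toℚ b + N - toℚ a       ∎
    where open ≡-Reasoning

  toℚ-⊖-flip : ∀ {a b} → a < n → b < n → a ≢ b → toℚ (a ⊖ b) ≡ N - toℚ (b ⊖ a)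
  toℚ-⊖-flip {a} {b} a<n b<n a≢b with ℕ.<-cmp a b
  ... | tri≈ _ a≡b _ = ⊥-elim (a≢b a≡b)
  ... | tri< a<b _ _ = begin
    toℚ (a ⊖ b)                 ≡⟨ toℚ-⊖-> a<b b<n ⟩
    toℚ a + N - toℚ b           ≡⟨ solve 3 (λ x y N → x :+ N :- y := N :- (y :- x)) refl (toℚ a) (toℚ b) N ⟩
    N - (toℚ b - toℚ a)         ≡⟨ cong (_-_ N) (toℚ-⊖-≤ (ℕ.<⇒≤ a<b) b<n) ⟨
    N - toℚ (b ⊖ a)             ∎
    where open ≡-Reasoning
  ... | tri> _ _ b<a = begin
    toℚ (a ⊖ b)                 ≡⟨ toℚ-⊖-≤ (ℕ.<⇒≤ b<a) a<n ⟩
    toℚ a - toℚ b               ≡⟨ solve 3 (λ x y N → x :- y := N :- (y :+ N :- x)) refl (toℚ a) (toℚ b) N ⟩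
    N - (toℚ b + N - toℚ a)     ≡⟨ cong (_-_ N) (toℚ-⊖-> b<a a<n) ⟨
    N - toℚ (b ⊖ a)             ∎
    where open ≡-Reasoning

-- The cycle on n = k + 3 vertices

module Cycle (k : ℕ) where

  m : ℕ
  m = suc (suc k)

  open Cyclic m public

  nextᶠ prevᶠ : Fin n → Fin n
  nextᶠ i = fromℕ< (next<n (toℕ i))
  prevᶠ i = fromℕ< (prev<n (toℕ<n i))

  toℕ-nextᶠ : ∀ i → toℕ (nextᶠ i) ≡ next (toℕ i)
  toℕ-nextᶠ i = toℕ-fromℕ< (next<n (toℕ i))

  toℕ-prevᶠ : ∀ i → toℕ (prevᶠ i) ≡ prev (toℕ i)
  toℕ-prevᶠ i = toℕ-fromℕ< (prev<n (toℕ<n i))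

  next≢prev : ∀ {a} → a < n → next a ≢ prev a
  next≢prev {a} a<n with ℕ.m≤n⇒m<n∨m≡n (ℕ.≤-pred a<n)
  ... | inj₂ refl = λ next≡prev → ℕ.0≢1+n (trans (sym next-last) next≡prev)
  ... | inj₁ a<m  = λ next≡prev → 1+a≢prev a (trans (sym (next-< (s≤s a<m))) next≡prev)
    where
    1+a≢prev : ∀ a → suc a ≢ prev a
    1+a≢prev zero    ()
    1+a≢prev (suc a) 2+a≡a = ℕ.<⇒≢ (ℕ.<-trans (ℕ.n<1+n a) (ℕ.n<1+n (suc a))) (sym 2+a≡a)

  cycleAdj-split : ∀ i j → cycleAdj n i j ≡ δ (nextᶠ i) j 1ℚ + δ (prevᶠ i) j 1ℚ
  cycleAdj-split i j = split (next a ℕ.≟ b) (next b ℕ.≟ a)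
    where
    a = toℕ i
    b = toℕ j
    nextᶠ≡ : next a ≡ b → nextᶠ i ≡ j
    nextᶠ≡ next≡ = toℕ-injective (trans (toℕ-nextᶠ i) next≡)
    nextᶠ≢ : next a ≢ b → nextᶠ i ≢ j
    nextᶠ≢ next≢ nextᶠ≡j = next≢ (trans (sym (toℕ-nextᶠ i)) (cong toℕ nextᶠ≡j))
    prevᶠ≡ : next b ≡ a → prevᶠ i ≡ j
    prevᶠ≡ next≡ = toℕ-injective (trans (toℕ-prevᶠ i) (trans (cong prev (sym next≡)) (prev-next (toℕ<n j))))
    prevᶠ≢ : next b ≢ a → prevᶠ i ≢ j
    prevᶠ≢ next≢ prevᶠ≡j =
      next≢ (trans (cong next (trans (sym (cong toℕ prevᶠ≡j)) (toℕ-prevᶠ i))) (next-prev (toℕ<n i)))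
    split : (p : Dec (next a ≡ b)) (q : Dec (next b ≡ a)) →
            (if ⌊ p ⌋ ∨ ⌊ q ⌋ then 1ℚ else 0ℚ) ≡ δ (nextᶠ i) j 1ℚ + δ (prevᶠ i) j 1ℚ
    split (yes next≡) (yes next≡′) =
      ⊥-elim (next≢prev (toℕ<n i) (trans next≡ (trans (sym (prev-next (toℕ<n j))) (cong prev next≡′))))
    split (yes next≡) (no  next≢′) = sym (cong₂ _+_ (δ-≡ 1ℚ (nextᶠ≡ next≡)) (δ-≢ 1ℚ (prevᶠ≢ next≢′)))
    split (no  next≢) (yes next≡′) = sym (cong₂ _+_ (δ-≢ 1ℚ (nextᶠ≢ next≢)) (δ-≡ 1ℚ (prevᶠ≡ next≡′)))
    split (no  next≢) (no  next≢′) = sym (cong₂ _+_ (δ-≢ 1ℚ (nextᶠ≢ next≢)) (δ-≢ 1ℚ (prevᶠ≢ next≢′)))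

  cycleAdj-sym : ∀ i j → cycleAdj n i j ≡ cycleAdj n j i
  cycleAdj-sym i j =
    cong (λ b → if b then 1ℚ else 0ℚ) (∨-comm ⌊ next (toℕ i) ℕ.≟ toℕ j ⌋ ⌊ next (toℕ j) ℕ.≟ toℕ i ⌋)

  cycleAdj-sum : ∀ i (f : Fin n → ℚ) → sum (λ l → cycleAdj n i l * f l) ≡ f (nextᶠ i) + f (prevᶠ i)
  cycleAdj-sum i f = begin
    sum (λ l → cycleAdj n i l * f l)
      ≡⟨ sum-cong-≗ (λ l → trans (cong (_* f l) (cycleAdj-split i l)) (*-distribʳ-+ (f l) (δ (nextᶠ i) l 1ℚ) (δ (prevᶠ i) l 1ℚ))) ⟩
    sum (λ l → δ (nextᶠ i) l 1ℚ * f l + δ (prevᶠ i) l 1ℚ * f l)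
      ≡⟨ ∑-distrib-+ (λ l → δ (nextᶠ i) l 1ℚ * f l) (λ l → δ (prevᶠ i) l 1ℚ * f l) ⟩
    sum (λ l → δ (nextᶠ i) l 1ℚ * f l) + sum (λ l → δ (prevᶠ i) l 1ℚ * f l)
      ≡⟨ cong₂ _+_ (sum-δ (nextᶠ i) 1ℚ f) (sum-δ (prevᶠ i) 1ℚ f) ⟩
    1ℚ * f (nextᶠ i) + 1ℚ * f (prevᶠ i)
      ≡⟨ cong₂ _+_ (*-identityˡ (f (nextᶠ i))) (*-identityˡ (f (prevᶠ i))) ⟩
    f (nextᶠ i) + f (prevᶠ i) ∎
    where open ≡-Reasoning

  degree-cycle : ∀ i → degree n i ≡ 2ℚ
  degree-cycle i = begin
    degree n i                         ≡⟨ sumFin≡sum n (cycleAdj n i) ⟩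
    sum (cycleAdj n i)                 ≡⟨ sum-cong-≗ (λ l → sym (*-identityʳ (cycleAdj n i l))) ⟩
    sum (λ l → cycleAdj n i l * 1ℚ)    ≡⟨ cycleAdj-sum i (λ _ → 1ℚ) ⟩
    1ℚ + 1ℚ                            ∎
    where open ≡-Reasoning

  L : Matrix n
  L = cycleLap n

  L⊗-entry : ∀ (B : Matrix n) i j → (L ⊗ B) i j ≡ 2ℚ * B i j - (B (nextᶠ i) j + B (prevᶠ i) j)
  L⊗-entry B i j = begin
    (L ⊗ B) i j                                     ≡⟨ ⊗≡sum L B i j ⟩
    sum (λ l → (δ i l (degree n i) - cycleAdj n i l) * B l j)
      ≡⟨ sum-cong-≗ (λ l → solve 3 (λ d a b → (d :- a) :* b := d :* b :- a :* b) refl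
                                    (δ i l (degree n i)) (cycleAdj n i l) (B l j)) ⟩
    sum (λ l → δ i l (degree n i) * B l j - cycleAdj n i l * B l j)
      ≡⟨ ∑-distrib-- (λ l → δ i l (degree n i) * B l j) (λ l → cycleAdj n i l * B l j) ⟩
    sum (λ l → δ i l (degree n i) * B l j) - sum (λ l → cycleAdj n i l * B l j)
      ≡⟨ cong₂ _-_ (sum-δ i (degree n i) (λ l → B l j)) (cycleAdj-sum i (λ l → B l j)) ⟩
    degree n i * B i j - (B (nextᶠ i) j + B (prevᶠ i) j)
      ≡⟨ cong (λ d → d * B i j - (B (nextᶠ i) j + B (prevᶠ i) j)) (degree-cycle i) ⟩
    2ℚ * B i j - (B (nextᶠ i) j + B (prevᶠ i) j)    ∎
    where open ≡-Reasoning

  L-symmetric : IsSymmetric L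
  L-symmetric i j = cong₂ _-_ δ-deg (cycleAdj-sym j i)
    where
    δ-deg : δ j i (degree n j) ≡ δ i j (degree n i)
    δ-deg = trans (cong (δ j i) (degree-cycle j))
                  (trans (δ-sym j i 2ℚ) (cong (δ i j) (sym (degree-cycle i))))

  L-colSum : ∀ j → sum (λ i → L i j) ≡ 0ℚ
  L-colSum j = begin
    sum (λ i → L i j)                     ≡⟨ sum-cong-≗ (λ i → trans (L-symmetric j i) (sym (*-identityʳ (L j i)))) ⟩
    sum (λ i → L j i * 1ℚ)                ≡⟨ ⊗≡sum L (λ _ _ → 1ℚ) j j ⟨
    (L ⊗ (λ _ _ → 1ℚ)) j j                ≡⟨ L⊗-entry (λ _ _ → 1ℚ) j j ⟩
    2ℚ * 1ℚ - (1ℚ + 1ℚ)                   ∎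
    where open ≡-Reasoning

  w : ℚ
  w = + 1 / n

  w*N≡1 : w * N ≡ 1ℚ
  w*N≡1 = /-*-cancel 1 m

  N≡1+toℚm : N ≡ 1ℚ + toℚ m
  N≡1+toℚm = toℚ-suc m

  g : ℚ → ℚ
  g x = (N * N - 1ℚ) * w * (+ 1 / 12) - x * (N - x) * w * ½

  gᴾ : ∀ {v} → Polynomial v → Polynomial v → Polynomial v → Polynomial v
  gᴾ N w x = (N :* N :- con 1ℚ) :* w :* con (+ 1 / 12) :- x :* (N :- x) :* w :* con ½

  g-reflect : ∀ x → g (N - x) ≡ g x
  g-reflect x = solve 3 (λ N w x → gᴾ N w (N :- x) := gᴾ N w x) refl N w x

  g-secondDiff : ∀ y → 2ℚ * g y - (g (y - 1ℚ) + g (y + 1ℚ)) ≡ - w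
  g-secondDiff y = solve 3 (λ N w y →
    con 2ℚ :* gᴾ N w y :- (gᴾ N w (y :- con 1ℚ) :+ gᴾ N w (y :+ con 1ℚ)) := :- w) refl N w y

  g-secondDiff-0 : 2ℚ * g 0ℚ - (g 1ℚ + g 1ℚ) ≡ 1ℚ - w
  g-secondDiff-0 = trans (solve 2 (λ N w →
    con 2ℚ :* gᴾ N w (con 0ℚ) :- (gᴾ N w (con 1ℚ) :+ gᴾ N w (con 1ℚ)) := w :* N :- w) refl N w)
    (cong (_- w) w*N≡1)

  ĝ : ℕ → ℚ
  ĝ d = g (toℚ d)

  L⁺ : Matrix n
  L⁺ = circ n ĝ

  ĝ-next : ∀ {d} → d < n → ĝ (next d) ≡ g (toℚ d + 1ℚ)
  ĝ-next {d} d<n with ℕ.m≤n⇒m<n∨m≡n d<n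
  ... | inj₁ 1+d<n = trans (cong ĝ (next-< 1+d<n)) (cong g (trans (toℚ-suc d) (+-comm 1ℚ (toℚ d))))
  ... | inj₂ refl  = begin
    ĝ (next m)         ≡⟨ cong ĝ next-last ⟩
    g 0ℚ               ≡⟨ g-reflect 0ℚ ⟨
    g (N - 0ℚ)         ≡⟨ cong (λ x → g (x - 0ℚ)) N≡1+toℚm ⟩
    g (1ℚ + toℚ m - 0ℚ) ≡⟨ cong g (solve 1 (λ x → con 1ℚ :+ x :- con 0ℚ := x :+ con 1ℚ) refl (toℚ m)) ⟩
    g (toℚ m + 1ℚ)     ∎
    where open ≡-Reasoning

  Δ²ĝ : ℕ → ℚ
  Δ²ĝ d = 2ℚ * ĝ d - (ĝ (prev d) + ĝ (next d))

  Δ²ĝ-zero : Δ²ĝ 0 ≡ 1ℚ - w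
  Δ²ĝ-zero = begin
    2ℚ * g 0ℚ - (ĝ m + ĝ (next 0))   ≡⟨ cong₂ (λ x y → 2ℚ * g 0ℚ - (x + y)) ĝ-m (ĝ-next {0} (s≤s ℕ.z≤n)) ⟩
    2ℚ * g 0ℚ - (g 1ℚ + g 1ℚ)        ≡⟨ g-secondDiff-0 ⟩
    1ℚ - w                            ∎
    where
    open ≡-Reasoning
    ĝ-m : ĝ m ≡ g 1ℚ
    ĝ-m = begin
      g (toℚ m)      ≡⟨ cong g (solve 1 (λ x → x := (con 1ℚ :+ x) :- con 1ℚ) refl (toℚ m)) ⟩
      g (1ℚ + toℚ m - 1ℚ) ≡⟨ cong (λ x → g (x - 1ℚ)) N≡1+toℚm ⟨
      g (N - 1ℚ)     ≡⟨ g-reflect 1ℚ ⟩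
      g 1ℚ           ∎

  Δ²ĝ-nonzero : ∀ {d} → d < n → d ≢ 0 → Δ²ĝ d ≡ - w
  Δ²ĝ-nonzero {zero}  _   0≢0 = ⊥-elim (0≢0 refl)
  Δ²ĝ-nonzero {suc e} d<n _   = begin
    2ℚ * g y - (g (toℚ e) + ĝ (next (suc e)))  ≡⟨ cong₂ (λ x z → 2ℚ * g y - (g x + z)) toℚe≡y-1 (ĝ-next d<n) ⟩
    2ℚ * g y - (g (y - 1ℚ) + g (y + 1ℚ))       ≡⟨ g-secondDiff y ⟩
    - w                                         ∎
    where
    open ≡-Reasoning
    y = toℚ (suc e)
    toℚe≡y-1 : toℚ e ≡ y - 1ℚ
    toℚe≡y-1 = trans (solve 1 (λ x → x := (con 1ℚ :+ x) :- con 1ℚ) refl (toℚ e)) (cong (_- 1ℚ) (sym (toℚ-suc e)))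

  L⊗L⁺≡Δ²ĝ : ∀ i j → (L ⊗ L⁺) i j ≡ Δ²ĝ (toℕ j ⊖ toℕ i)
  L⊗L⁺≡Δ²ĝ i j = begin
    (L ⊗ L⁺) i j
      ≡⟨ L⊗-entry L⁺ i j ⟩
    2ℚ * ĝ (b ⊖ toℕ i) - (ĝ (b ⊖ toℕ (nextᶠ i)) + ĝ (b ⊖ toℕ (prevᶠ i)))
      ≡⟨ cong₂ (λ x y → 2ℚ * ĝ (b ⊖ toℕ i) - (ĝ (b ⊖ x) + ĝ (b ⊖ y))) (toℕ-nextᶠ i) (toℕ-prevᶠ i) ⟩
    2ℚ * ĝ (b ⊖ toℕ i) - (ĝ (b ⊖ next (toℕ i)) + ĝ (b ⊖ prev (toℕ i)))
      ≡⟨ cong₂ (λ x y → 2ℚ * ĝ (b ⊖ toℕ i) - (ĝ x + ĝ y)) (⊖-next b (toℕ<n i)) (⊖-prev b (toℕ<n i)) ⟩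
    Δ²ĝ (b ⊖ toℕ i) ∎
    where
    open ≡-Reasoning
    b = toℕ j

  centering : Matrix n
  centering i j = δ i j 1ℚ - w

  centering-symmetric : IsSymmetric centering
  centering-symmetric i j = cong (_- w) (δ-sym j i 1ℚ)

  centering-⊗ : ∀ (B : Matrix n) → (∀ j → sum (λ i → B i j) ≡ 0ℚ) → centering ⊗ B ≈ B
  centering-⊗ B B-colSum i j = begin
    (centering ⊗ B) i j                                        ≡⟨ ⊗≡sum centering B i j ⟩
    sum (λ l → (δ i l 1ℚ - w) * B l j)
      ≡⟨ sum-cong-≗ (λ l → solve 3 (λ d w b → (d :- w) :* b := d :* b :- w :* b) refl (δ i l 1ℚ) w (B l j)) ⟩
    sum (λ l → δ i l 1ℚ * B l j - w * B l j)
      ≡⟨ ∑-distrib-- (λ l → δ i l 1ℚ * B l j) (λ l → w * B l j) ⟩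
    sum (λ l → δ i l 1ℚ * B l j) - sum (λ l → w * B l j)
      ≡⟨ cong₂ _-_ (sum-δ i 1ℚ (λ l → B l j)) (sym (*-distribˡ-sum w (λ l → B l j))) ⟩
    1ℚ * B i j - w * sum (λ l → B l j)                         ≡⟨ cong (λ s → 1ℚ * B i j - w * s) (B-colSum j) ⟩
    1ℚ * B i j - w * 0ℚ                                        ≡⟨ solve 2 (λ b w → con 1ℚ :* b :- w :* con 0ℚ := b) refl (B i j) w ⟩
    B i j                                                      ∎
    where open ≡-Reasoning

  L⊗L⁺ : L ⊗ L⁺ ≈ centering
  L⊗L⁺ i j = byCases (i ≟ᶠ j)
    where
    open ≡-Reasoning
    byCases : Dec (i ≡ j) → (L ⊗ L⁺) i j ≡ centering i j
    byCases (yes refl) = begin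
      (L ⊗ L⁺) i i              ≡⟨ L⊗L⁺≡Δ²ĝ i i ⟩
      Δ²ĝ (toℕ i ⊖ toℕ i)       ≡⟨ cong Δ²ĝ (⊖-self (toℕ i)) ⟩
      Δ²ĝ 0                     ≡⟨ Δ²ĝ-zero ⟩
      1ℚ - w                    ≡⟨ cong (_- w) (δ-≡ {i = i} 1ℚ refl) ⟨
      centering i i             ∎
    byCases (no i≢j) = begin
      (L ⊗ L⁺) i j              ≡⟨ L⊗L⁺≡Δ²ĝ i j ⟩
      Δ²ĝ (toℕ j ⊖ toℕ i)       ≡⟨ Δ²ĝ-nonzero (⊖<n (toℕ i) (toℕ j)) (i≢j ∘ toℕ-injective ∘ ⊖≡0⇒≡ (toℕ<n i) (toℕ<n j)) ⟩
      - w                       ≡⟨ +-identityˡ (- w) ⟨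
      0ℚ - w                    ≡⟨ cong (_- w) (δ-≢ 1ℚ i≢j) ⟨
      centering i j             ∎

  L⁺-symmetric : IsSymmetric L⁺
  L⁺-symmetric i j with i ≟ᶠ j
  ... | yes refl = refl
  ... | no  i≢j  = trans (cong g (toℚ-⊖-flip (toℕ<n i) (toℕ<n j) (i≢j ∘ toℕ-injective))) (g-reflect _)

  L⁺⊗L : L⁺ ⊗ L ≈ centering
  L⁺⊗L i j = trans (⊗-flip L⁺-symmetric L-symmetric i j)
                   (trans (L⊗L⁺ j i) (centering-symmetric i j))

  reflectᶠ : Fin n → Fin n → Fin n
  reflectᶠ j i = fromℕ< (⊖<n (toℕ i) (toℕ j))

  reflectᶠ-involutive : ∀ j i → reflectᶠ j (reflectᶠ j i) ≡ i
  reflectᶠ-involutive j i = toℕ-injective (begin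
    toℕ (reflectᶠ j (reflectᶠ j i))   ≡⟨ toℕ-fromℕ< (⊖<n (toℕ (reflectᶠ j i)) (toℕ j)) ⟩
    toℕ j ⊖ toℕ (reflectᶠ j i)        ≡⟨ cong (toℕ j ⊖_) (toℕ-fromℕ< (⊖<n (toℕ i) (toℕ j))) ⟩
    toℕ j ⊖ (toℕ j ⊖ toℕ i)           ≡⟨ ⊖-involutive (toℕ<n i) (toℕ<n j) ⟩
    toℕ i                              ∎)
    where open ≡-Reasoning

  sum-ĝ : sum (λ (d : Fin n) → ĝ (toℕ d)) ≡ 0ℚ
  sum-ĝ = begin
    sum (λ (d : Fin n) → ĝ (toℕ d))
      ≡⟨ sum-cong-≗ (λ (d : Fin n) → g≡quadratic (toℚ (toℕ d))) ⟩
    sum (λ (d : Fin n) → quadratic a b c (toℚ (toℕ d)))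
      ≡⟨ sum-quadratic n a b c ⟩
    quadraticSum a b c N
      ≡⟨ solve 2 (λ N w → quadraticSumᴾ (gᴾ N w (con 0ℚ)) (:- (N :* w :* con ½)) (w :* con ½) N := con 0ℚ)
               refl N w ⟩
    0ℚ ∎
    where
    open ≡-Reasoning
    a = g 0ℚ
    b = - (N * w * ½)
    c = w * ½
    g≡quadratic : ∀ x → g x ≡ quadratic a b c x
    g≡quadratic x =
      solve 3 (λ N w x → gᴾ N w x := quadraticᴾ (gᴾ N w (con 0ℚ)) (:- (N :* w :* con ½)) (w :* con ½) x) refl N w x

  L⁺-colSum : ∀ j → sum (λ i → L⁺ i j) ≡ 0ℚ
  L⁺-colSum j = begin
    sum (λ (i : Fin n) → ĝ (toℕ j ⊖ toℕ i))
      ≡⟨ sum-cong-≗ {x = λ i → ĝ (toℕ j ⊖ toℕ i)} {y = λ i → ĝ (toℕ (reflectᶠ j i))}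
                    (λ i → cong ĝ (sym (toℕ-fromℕ< (⊖<n (toℕ i) (toℕ j))))) ⟩
    sum (λ i → ĝ (toℕ (reflectᶠ j i)))       ≡⟨ sum-∘-involutive (reflectᶠ j) (reflectᶠ-involutive j) (ĝ ∘ toℕ) ⟩
    sum (λ (d : Fin n) → ĝ (toℕ d))          ≡⟨ sum-ĝ ⟩
    0ℚ                                        ∎
    where open ≡-Reasoning

  L⁺-isMPInverse : IsMPInverse L L⁺
  L⁺-isMPInverse =
    isMPInverse L⊗L⁺ L⁺⊗L centering-symmetric (centering-⊗ L L-colSum) (centering-⊗ L⁺ L⁺-colSum)

  r : ℚ → ℚ
  r x = x * (N - x) * w

  L⁺-diagonal : ∀ i → L⁺ i i ≡ g 0ℚ
  L⁺-diagonal i = cong ĝ (⊖-self (toℕ i))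

  resDist-L⁺ : ∀ i j → resDist L⁺ i j ≡ r (toℚ (toℕ j ⊖ toℕ i))
  resDist-L⁺ i j = begin
    resDist L⁺ i j                              ≡⟨ resDist-formula L⁺ i j ⟩
    L⁺ i i + L⁺ j j - 2ℚ * L⁺ i j               ≡⟨ cong₂ (λ x y → x + y - 2ℚ * L⁺ i j) (L⁺-diagonal i) (L⁺-diagonal j) ⟩
    g 0ℚ + g 0ℚ - 2ℚ * g x                      ≡⟨ solve 3 (λ N w x →
        gᴾ N w (con 0ℚ) :+ gᴾ N w (con 0ℚ) :- con 2ℚ :* gᴾ N w x := x :* (N :- x) :* w) refl N w x ⟩
    r x                                         ∎
    where
    open ≡-Reasoning
    x = toℚ (toℕ j ⊖ toℕ i)

  resTr-L⁺ : ∀ v → resTr L⁺ v ≡ (N * N - 1ℚ) * (+ 1 / 6)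
  resTr-L⁺ v = begin
    resTr L⁺ v                                          ≡⟨ sumFin≡sum n (λ u → resDist L⁺ u v) ⟩
    sum (λ u → resDist L⁺ u v)
      ≡⟨ sum-cong-≗ {x = λ u → resDist L⁺ u v} {y = λ u → g 0ℚ + g 0ℚ - 2ℚ * L⁺ u v} (λ u →
           trans (resDist-formula L⁺ u v)
                 (cong₂ (λ x y → x + y - 2ℚ * L⁺ u v) (L⁺-diagonal u) (L⁺-diagonal v))) ⟩
    sum (λ u → g 0ℚ + g 0ℚ - 2ℚ * L⁺ u v)
      ≡⟨ ∑-distrib-- (λ _ → g 0ℚ + g 0ℚ) (λ u → 2ℚ * L⁺ u v) ⟩
    sum {n} (λ _ → g 0ℚ + g 0ℚ) - sum (λ u → 2ℚ * L⁺ u v)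
      ≡⟨ cong₂ _-_ (sum-const n (g 0ℚ + g 0ℚ)) (sym (*-distribˡ-sum 2ℚ (λ u → L⁺ u v))) ⟩
    (g 0ℚ + g 0ℚ) * N - 2ℚ * sum (λ u → L⁺ u v)            ≡⟨ cong (λ s → (g 0ℚ + g 0ℚ) * N - 2ℚ * s) (L⁺-colSum v) ⟩
    (g 0ℚ + g 0ℚ) * N - 2ℚ * 0ℚ                            ≡⟨ solve 2 (λ N w →
        (gᴾ N w (con 0ℚ) :+ gᴾ N w (con 0ℚ)) :* N :- con 2ℚ :* con 0ℚ
          := (N :* N :- con 1ℚ) :* (w :* N) :* con (+ 1 / 6)) refl N w ⟩
    (N * N - 1ℚ) * (w * N) * (+ 1 / 6)                  ≡⟨ cong (λ x → (N * N - 1ℚ) * x * (+ 1 / 6)) w*N≡1 ⟩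
    (N * N - 1ℚ) * 1ℚ * (+ 1 / 6)                       ≡⟨ cong (_* (+ 1 / 6)) (*-identityʳ (N * N - 1ℚ)) ⟩
    (N * N - 1ℚ) * (+ 1 / 6)                            ∎
    where open ≡-Reasoning

  cycleRow-zero : cycleRow n 0 ≡ (N * N - 1ℚ) * (+ 1 / 6)
  cycleRow-zero = begin
    + (n ℕ.* n ∸ 1) / 6                  ≡⟨ /≡*1/ (n ℕ.* n ∸ 1) 5 ⟩
    toℚ (n ℕ.* n ∸ 1) * (+ 1 / 6)        ≡⟨ cong (_* (+ 1 / 6)) (toℚ-∸ {n ℕ.* n} {1} (s≤s ℕ.z≤n)) ⟩
    (toℚ (n ℕ.* n) - 1ℚ) * (+ 1 / 6)     ≡⟨ cong (λ x → (x - 1ℚ) * (+ 1 / 6)) (toℚ-* n n) ⟩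
    (N * N - 1ℚ) * (+ 1 / 6)             ∎
    where open ≡-Reasoning

  cycleRow-nonzero : ∀ {d} → d < n → d ≢ 0 → cycleRow n d ≡ - r (toℚ d)
  cycleRow-nonzero {zero}  _   0≢0 = ⊥-elim (0≢0 refl)
  cycleRow-nonzero {suc e} d<n _   = begin
    - (+ (suc e ℕ.* (n ∸ suc e)) / n)          ≡⟨ cong -_ (/≡*1/ (suc e ℕ.* (n ∸ suc e)) m) ⟩
    - (toℚ (suc e ℕ.* (n ∸ suc e)) * w)        ≡⟨ cong (λ x → - (x * w)) (toℚ-* (suc e) (n ∸ suc e)) ⟩
    - (toℚ (suc e) * toℚ (n ∸ suc e) * w)      ≡⟨ cong (λ x → - (toℚ (suc e) * x * w)) (toℚ-∸ (ℕ.<⇒≤ d<n)) ⟩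
    - r (toℚ (suc e))                          ∎
    where open ≡-Reasoning

  resLap-L⁺ : resLap L⁺ ≈ circ n (cycleRow n)
  resLap-L⁺ i j = byCases (i ≟ᶠ j)
    where
    open ≡-Reasoning
    byCases : Dec (i ≡ j) → resLap L⁺ i j ≡ circ n (cycleRow n) i j
    byCases (yes refl) = begin
      δ i i (resTr L⁺ i) - resDist L⁺ i i   ≡⟨ cong₂ _-_ (δ-≡ {i = i} (resTr L⁺ i) refl) (resDist-L⁺ i i) ⟩
      resTr L⁺ i - r (toℚ (toℕ i ⊖ toℕ i))  ≡⟨ cong₂ (λ t d → t - r (toℚ d)) (resTr-L⁺ i) (⊖-self (toℕ i)) ⟩
      (N * N - 1ℚ) * (+ 1 / 6) - r 0ℚ
        ≡⟨ solve 2 (λ N w → (N :* N :- con 1ℚ) :* con (+ 1 / 6) :- con 0ℚ :* (N :- con 0ℚ) :* w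
                            := (N :* N :- con 1ℚ) :* con (+ 1 / 6)) refl N w ⟩
      (N * N - 1ℚ) * (+ 1 / 6)              ≡⟨ cycleRow-zero ⟨
      cycleRow n 0                           ≡⟨ cong (cycleRow n) (⊖-self (toℕ i)) ⟨
      cycleRow n (toℕ i ⊖ toℕ i)             ∎
    byCases (no i≢j) = begin
      δ i j (resTr L⁺ i) - resDist L⁺ i j   ≡⟨ cong₂ _-_ (δ-≢ (resTr L⁺ i) i≢j) (resDist-L⁺ i j) ⟩
      0ℚ - r (toℚ d)                         ≡⟨ +-identityˡ (- r (toℚ d)) ⟩
      - r (toℚ d)                            ≡⟨ cycleRow-nonzero (⊖<n (toℕ i) (toℕ j)) d≢0 ⟨
      cycleRow n d                           ∎
      where
      d = toℕ j ⊖ toℕ i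
      d≢0 : d ≢ 0
      d≢0 = i≢j ∘ toℕ-injective ∘ ⊖≡0⇒≡ (toℕ<n i) (toℕ<n j)

mainTheorem9 : (n : ℕ) → 3 ≤ n →
    (∃ λ X → IsMPInverse (cycleLap n) X) ×
    (∀ X → IsMPInverse (cycleLap n) X →
      ∀ i j → resLap X i j ≡ circ n (cycleRow n) i j)
mainTheorem9 (suc (suc (suc k))) (s≤s (s≤s (s≤s _))) =
    (L⁺ , L⁺-isMPInverse)
  , λ X X-isMPInverse i j →
      trans (resLap-cong (IsMPInverse-unique X-isMPInverse L⁺-isMPInverse) i j) (resLap-L⁺ i j)
  where open Cycle k
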